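{- Let $a,r\in\mathbb{N}$ with $r\ge2$, let $a_n=ar^{n-1}+1$ for $n\ge1$, and set $d=\gcd(a+1,r-1)$. (1) Suppose $d$ is odd. If $a+1$ does not divide $r-1$, then the sequence $(\Gamma(a_n,a_{n+1}))_{n\ge1}$ is constant. If $a+1$ divides $r-1$, then $\Gamma(a_1,a_2)=1$ and $\Gamma(a_n,a_{n+1})=2$ for all $n\ge2$. (2) If $d$ is even, then the sequence $(\Gamma(a_n,a_{n+1}))_{n\ge2}$ alternates between $1$ and $2$.
   Context: $\mathbb{N}$ denotes the positive integers. For coprime $a,b\in\mathbb{N}$, consider the equations (E1) $ax+by=\frac{(a-1)(b-1)}{2}$ and (E2) $ax+by+1=\frac{(a-1)(b-1)}{2}$. We say the pair $(a,b)$ uses (E1) if (E1) has a solution in nonnegative integers $x,y$. For arbitrary $a,b\in\mathbb{N}$ with $d=\gcd(a,b)$, define $\Gamma(a,b)=1$ if the coprime pair $(a/d,b/d)$ uses (E1), and $\Gamma(a,b)=2$ otherwise. -}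

module Defs where

open import Data.Nat using (ℕ; _+_; _*_; _∸_; _^_; _/_)
open import Data.Nat.GCD using (gcd; gcd[m,n]∣m; gcd[m,n]∣n)
open import Data.Nat.Divisibility using (_∣_)
open import Data.Product using (∃₂; _×_)
open import Data.Sum using (_⊎_)
open import Relation.Binary.PropositionalEquality using (_≡_)
open import Relation.Nullary using (¬_)

-- (E1) solvable in nonnegative integers: a x + b y = (a-1)(b-1)/2
-- (for coprime a,b ≥ 1 the product (a-1)(b-1) is even, so ⌊·/2⌋ is exact)
UsesE1 : ℕ → ℕ → Set
UsesE1 a b = ∃₂ λ x y → a * x + b * y ≡ ((a ∸ 1) * (b ∸ 1)) / 2

redL : ℕ → ℕ → ℕ
redL a b = _∣_.quotient (gcd[m,n]∣m a b)

redR : ℕ → ℕ → ℕ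
redR a b = _∣_.quotient (gcd[m,n]∣n a b)

-- Γ(a,b) = k, as a relation: Γ(a,b)=1 iff (a/d,b/d) uses (E1), otherwise 2.
-- Exactly one value k satisfies  GammaIs a b k.
GammaIs : ℕ → ℕ → ℕ → Set
GammaIs a b k = (k ≡ 1 × UsesE1 (redL a b) (redR a b))
              ⊎ (k ≡ 2 × ¬ UsesE1 (redL a b) (redR a b))

seqA : ℕ → ℕ → ℕ → ℕ
seqA a r n = a * r ^ (n ∸ 1) + 1

{-# OPTIONS --safe #-}

-- Write g = gcd (a + 1) (r - 1), a + 1 = p g and r - 1 = k g.  Then a_(m+1) = g A_m with
-- A_m = p + k a (1 + r + ... + r^(m-1)), consecutive A_m are coprime, and Γ(a_(m+1), a_(m+2))
-- is decided by the pair (A_m, A_(m+1)).  For coprime X, Y the equation (E1) says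
-- X (2x+1) + Y (2y+1) = X Y + 1, and a representation X Y + 1 = X u + Y v with v ≥ 1 is unique,
-- so Γ(X, Y) = 1 iff u and v are both odd.  For (A_m, A_(m+1)) such a representation is explicit,
-- and its parity depends on m only through the parity of 1 + r + ... + r^(m-1): it is constant
-- when g is odd and flips with m when g is even.  When a + 1 divides r - 1 we have p = 1, so
-- A_0 = 1, which accounts for the exceptional first term.

module Submission where

open import Defs
open import Data.Nat
open import Data.Nat.Coprimality as Coprimality
  using (Coprime; coprime-divisor; coprime⇒gcd≡1; coprime-Bézout; GCD≡1⇒coprime; 1-coprimeTo)
open import Data.Nat.Divisibility
open import Data.Nat.DivMod using (m%n<n; m≡m%n+[m/n]*n; m*n/n≡m; m/n*n≡m)
open import Data.Nat.GCD
open import Data.Nat.Properties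
open import Data.Nat.Solver using (module +-*-Solver)
open import Data.Parity.Base as ℙ using (Parity; 0ℙ; 1ℙ; _⁻¹)
open import Data.Parity.Properties as ℙ using (+-homo-+; *-homo-*; ⁻¹-selfInverse)
open import Data.Product using (∃; ∃-syntax; _×_; _,_; proj₁; proj₂)
open import Data.Sum using (inj₁; inj₂)
open import Function.Bundles using (_⇔_; mk⇔; Equivalence)
open import Relation.Binary.PropositionalEquality
open import Relation.Nullary using (¬_; contradiction)

open +-*-Solver using (solve; _:+_; _:*_; con; _:=_)

parity-+1 : ∀ n → parity (n + 1) ≡ parity n ⁻¹
parity-+1 n = trans (+-homo-+ n 1) (ℙ.+-comm (parity n) 1ℙ)

parity-∸ : ∀ {m n} → n ≤ m → parity (m ∸ n) ≡ parity m ℙ.+ parity n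
parity-∸ {m} {n} n≤m = move (parity (m ∸ n)) (parity n) (begin
  parity m               ≡⟨ cong parity (m∸n+n≡m n≤m) ⟨
  parity (m ∸ n + n)     ≡⟨ +-homo-+ (m ∸ n) n ⟩
  parity (m ∸ n) ℙ.+ parity n ∎)
  where
  open ≡-Reasoning
  move : ∀ {x} y z → x ≡ y ℙ.+ z → y ≡ x ℙ.+ z
  move 0ℙ 0ℙ refl = refl
  move 0ℙ 1ℙ refl = refl
  move 1ℙ 0ℙ refl = refl
  move 1ℙ 1ℙ refl = refl

2∣⇒parity≡0ℙ : ∀ {n} → 2 ∣ n → parity n ≡ 0ℙ
2∣⇒parity≡0ℙ (divides q refl) = trans (*-homo-* q 2) (ℙ.*-zeroʳ (parity q))

parity≡0ℙ⇒2∣ : ∀ n → parity n ≡ 0ℙ → 2 ∣ n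
parity≡0ℙ⇒2∣ zero          _ = divides 0 refl
parity≡0ℙ⇒2∣ (suc (suc n)) e with parity≡0ℙ⇒2∣ n e
... | divides h refl = divides (suc h) refl

¬2∣⇒parity≡1ℙ : ∀ {n} → ¬ 2 ∣ n → parity n ≡ 1ℙ
¬2∣⇒parity≡1ℙ {n} ¬2∣n with parity n in e
... | 0ℙ = contradiction (parity≡0ℙ⇒2∣ n e) ¬2∣n
... | 1ℙ = refl

parity≡1ℙ⇒odd : ∀ n → parity n ≡ 1ℙ → ∃[ h ] n ≡ suc (h * 2)
parity≡1ℙ⇒odd (suc zero)    _ = 0 , refl
parity≡1ℙ⇒odd (suc (suc n)) e with parity≡1ℙ⇒odd n e
... | h , refl = suc h , refl

parity≡1ℙ⇒2∣suc : ∀ {n} → parity n ≡ 1ℙ → 2 ∣ suc n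
parity≡1ℙ⇒2∣suc {n} e with parity≡1ℙ⇒odd n e
... | h , refl = divides (suc h) refl

parity-odd : ∀ h → parity (suc (h * 2)) ≡ 1ℙ
parity-odd h = trans (+-homo-+ 1 (h * 2)) (cong (1ℙ ℙ.+_) (2∣⇒parity≡0ℙ (divides h refl)))

*≡1ℙ⇒both≡1ℙ : ∀ {x y} → x ℙ.* y ≡ 1ℙ → x ≡ 1ℙ × y ≡ 1ℙ
*≡1ℙ⇒both≡1ℙ {1ℙ} {1ℙ} _ = refl , refl

representation⇒coprime : ∀ {X Y u v} → X * u + Y * v ≡ X * Y + 1 → Coprime X Y
representation⇒coprime {X} {Y} {u} {v} rep {d} (d∣X , d∣Y) =
  ∣1⇒≡1 (∣m+n∣m⇒∣n (subst (d ∣_) rep (∣m∣n⇒∣m+n (∣m⇒∣m*n u d∣X) (∣m⇒∣m*n v d∣Y)))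
                   (∣m⇒∣m*n Y d∣X))

representation-bound : ∀ {X Y u v} → 2 ≤ Y → 1 ≤ v → X * u + Y * v ≡ X * Y + 1 → u < Y
representation-bound {X} {Y} {u} {v} 2≤Y 1≤v rep =
  *-cancelˡ-< X u Y (+-cancelʳ-< Y (X * u) (X * Y) (begin-strict
    X * u + Y      ≤⟨ +-monoʳ-≤ (X * u) (m≤m*n Y v {{>-nonZero 1≤v}}) ⟩
    X * u + Y * v  ≡⟨ rep ⟩
    X * Y + 1      <⟨ +-monoʳ-< (X * Y) 2≤Y ⟩
    X * Y + Y      ∎))
  where open ≤-Reasoning

∣∧<⇒≡0 : ∀ {m n} → m ∣ n → n < m → n ≡ 0
∣∧<⇒≡0 {n = zero}  _   _   = refl
∣∧<⇒≡0 {n = suc _} m∣n n<m = contradiction m∣n (>⇒∤ n<m)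

module _ {X Y : ℕ} (coprime : Coprime Y X) where

  private
    representation-unique-≤ : ∀ {u v u' v'} → X * u + Y * v ≡ X * u' + Y * v' →
                              u ≤ u' → u' < Y → u ≡ u'
    representation-unique-≤ {u} {v} {u'} {v'} rep u≤u' u'<Y =
      trans (sym (+-identityʳ u)) (trans (cong (u +_) (sym δ≡0)) (m+[n∸m]≡n u≤u'))
      where
      δ : ℕ
      δ = u' ∸ u
      Yv≡Xδ+Yv' : Y * v ≡ Y * v' + X * δ
      Yv≡Xδ+Yv' = +-cancelˡ-≡ (X * u) _ _ (begin
        X * u + Y * v                ≡⟨ rep ⟩
        X * u' + Y * v'              ≡⟨ cong (λ z → X * z + Y * v') (m+[n∸m]≡n u≤u') ⟨
        X * (u + δ) + Y * v'         ≡⟨ solve 5 (λ X u δ Y v' → X :* (u :+ δ) :+ Y :* v'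
                                                 := X :* u :+ (Y :* v' :+ X :* δ)) refl X u δ Y v' ⟩
        X * u + (Y * v' + X * δ)     ∎)
        where open ≡-Reasoning
      δ≡0 : δ ≡ 0
      δ≡0 = ∣∧<⇒≡0 (coprime-divisor coprime
                     (∣m+n∣m⇒∣n (subst (Y ∣_) Yv≡Xδ+Yv' (m∣m*n v)) (m∣m*n v')))
                   (≤-<-trans (m∸n≤m u' u) u'<Y)

  representation-unique : ∀ {u v u' v'} → X * u + Y * v ≡ X * u' + Y * v' →
                          u < Y → u' < Y → u ≡ u'
  representation-unique {u} {u' = u'} rep u<Y u'<Y with ≤-total u u'
  ... | inj₁ u≤u' = representation-unique-≤ rep u≤u' u'<Y
  ... | inj₂ u'≤u = sym (representation-unique-≤ (sym rep) u'≤u u<Y)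

2∣pred*pred : ∀ {X' Y'} → Coprime (suc X') (suc Y') → 2 ∣ X' * Y'
2∣pred*pred {X'} {Y'} coprime = parity≡0ℙ⇒2∣ (X' * Y') (trans (*-homo-* X' Y') not-both-odd)
  where
  not-both-odd : parity X' ℙ.* parity Y' ≡ 0ℙ
  not-both-odd with parity X' in eX | parity Y' in eY
  ... | 0ℙ | _  = refl
  ... | 1ℙ | 0ℙ = refl
  ... | 1ℙ | 1ℙ = contradiction (coprime (parity≡1ℙ⇒2∣suc eX , parity≡1ℙ⇒2∣suc eY)) λ ()

odd-representation⇔ : ∀ X' Y' x y →
  (suc X' * suc (x * 2) + suc Y' * suc (y * 2) ≡ suc X' * suc Y' + 1)
    ⇔ ((suc X' * x + suc Y' * y) * 2 ≡ X' * Y')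
odd-representation⇔ X' Y' x y = mk⇔
  (λ e → +-cancelˡ-≡ (suc X' + suc Y') _ _ (trans (sym lhs) (trans e rhs)))
  (λ e → trans lhs (trans (cong (suc X' + suc Y' +_) e) (sym rhs)))
  where
  lhs : suc X' * suc (x * 2) + suc Y' * suc (y * 2) ≡ suc X' + suc Y' + (suc X' * x + suc Y' * y) * 2
  lhs = solve 4 (λ X' Y' x y → (con 1 :+ X') :* (con 1 :+ x :* con 2) :+ (con 1 :+ Y') :* (con 1 :+ y :* con 2)
                  := (con 1 :+ X') :+ (con 1 :+ Y') :+ ((con 1 :+ X') :* x :+ (con 1 :+ Y') :* y) :* con 2)
                refl X' Y' x y
  rhs : suc X' * suc Y' + 1 ≡ suc X' + suc Y' + X' * Y'
  rhs = solve 2 (λ X' Y' → (con 1 :+ X') :* (con 1 :+ Y') :+ con 1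
                  := (con 1 :+ X') :+ (con 1 :+ Y') :+ X' :* Y')
                refl X' Y'

usesE1⇔odd-representation : ∀ {X Y u v} → 1 ≤ X → 2 ≤ Y → 1 ≤ v → X * u + Y * v ≡ X * Y + 1 →
                             UsesE1 X Y ⇔ (parity u ℙ.* parity v ≡ 1ℙ)
usesE1⇔odd-representation {suc X'} {suc Y'} {u} {v} _ 2≤Y 1≤v rep = mk⇔ usesE1⇒odd odd⇒usesE1
  where
  X Y : ℕ
  X = suc X'
  Y = suc Y'

  coprime : Coprime X Y
  coprime = representation⇒coprime {X} {Y} {u} {v} rep

  odd⇒usesE1 : parity u ℙ.* parity v ≡ 1ℙ → UsesE1 X Y
  odd⇒usesE1 uv-odd with *≡1ℙ⇒both≡1ℙ uv-odd
  ... | u-odd , v-odd with parity≡1ℙ⇒odd u u-odd | parity≡1ℙ⇒odd v v-odd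
  ... | x , refl | y , refl = x , y , (begin
    X * x + Y * y                  ≡⟨ m*n/n≡m (X * x + Y * y) 2 ⟨
    (X * x + Y * y) * 2 / 2        ≡⟨ cong (_/ 2) (Equivalence.to (odd-representation⇔ X' Y' x y) rep) ⟩
    X' * Y' / 2                    ∎)
    where open ≡-Reasoning

  usesE1⇒odd : UsesE1 X Y → parity u ℙ.* parity v ≡ 1ℙ
  usesE1⇒odd (x , y , e) = begin
    parity u ℙ.* parity v                            ≡⟨ cong₂ (λ u v → parity u ℙ.* parity v) u≡ v≡ ⟩
    parity (suc (x * 2)) ℙ.* parity (suc (y * 2))    ≡⟨ cong₂ ℙ._*_ (parity-odd x) (parity-odd y) ⟩
    1ℙ                                               ∎
    where
    open ≡-Reasoning
    rep' : X * suc (x * 2) + Y * suc (y * 2) ≡ X * Y + 1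
    rep' = Equivalence.from (odd-representation⇔ X' Y' x y)
             (trans (cong (_* 2) e) (m/n*n≡m (2∣pred*pred {X'} {Y'} coprime)))
    u≡ : u ≡ suc (x * 2)
    u≡ = representation-unique (Coprimality.sym coprime) (trans rep (sym rep'))
           (representation-bound {X} 2≤Y 1≤v rep) (representation-bound {X} 2≤Y (s≤s z≤n) rep')
    v≡ : v ≡ suc (y * 2)
    v≡ = *-cancelˡ-≡ v (suc (y * 2)) Y (+-cancelˡ-≡ (X * u) _ _
           (trans rep (trans (sym rep') (cong (λ z → X * z + Y * suc (y * 2)) (sym u≡)))))

usesE1-1 : ∀ Y → UsesE1 1 Y
usesE1-1 Y = 0 , 0 , *-zeroʳ Y

gammaOf : Parity → ℕ
gammaOf 1ℙ = 1
gammaOf 0ℙ = 2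

3∸gammaOf : ∀ e → 3 ∸ gammaOf e ≡ gammaOf (e ⁻¹)
3∸gammaOf 0ℙ = refl
3∸gammaOf 1ℙ = refl

GammaIs-gammaOf : ∀ {x y} e → (UsesE1 (redL x y) (redR x y) ⇔ (e ≡ 1ℙ)) → GammaIs x y (gammaOf e)
GammaIs-gammaOf 1ℙ usesE1⇔ = inj₁ (refl , Equivalence.from usesE1⇔ refl)
GammaIs-gammaOf 0ℙ usesE1⇔ = inj₂ (refl , λ usesE1 → contradiction (Equivalence.to usesE1⇔ usesE1) λ ())

GammaIs-functional : ∀ {x y c c'} → GammaIs x y c → GammaIs x y c' → c ≡ c'
GammaIs-functional (inj₁ (refl , _))      (inj₁ (refl , _))      = refl
GammaIs-functional (inj₁ (_ , usesE1))    (inj₂ (_ , ¬usesE1))   = contradiction usesE1 ¬usesE1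
GammaIs-functional (inj₂ (_ , ¬usesE1))   (inj₁ (_ , usesE1))    = contradiction usesE1 ¬usesE1
GammaIs-functional (inj₂ (refl , _))      (inj₂ (refl , _))      = refl

module _ (g : ℕ) .{{_ : NonZero g}} {X Y : ℕ} (coprime : Coprime X Y) where

  private
    gcd≡g : gcd (g * X) (g * Y) ≡ g
    gcd≡g = trans (sym (c*gcd[m,n]≡gcd[cm,cn] g X Y)) (trans (cong (g *_) (coprime⇒gcd≡1 coprime)) (*-identityʳ g))

  redL-*-coprime : redL (g * X) (g * Y) ≡ X
  redL-*-coprime = *-cancelʳ-≡ _ X g (begin
    redL (g * X) (g * Y) * g                   ≡⟨ cong (redL (g * X) (g * Y) *_) gcd≡g ⟨
    redL (g * X) (g * Y) * gcd (g * X) (g * Y) ≡⟨ _∣_.equality (gcd[m,n]∣m (g * X) (g * Y)) ⟨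
    g * X                                      ≡⟨ *-comm g X ⟩
    X * g                                      ∎)
    where open ≡-Reasoning

  redR-*-coprime : redR (g * X) (g * Y) ≡ Y
  redR-*-coprime = *-cancelʳ-≡ _ Y g (begin
    redR (g * X) (g * Y) * g                   ≡⟨ cong (redR (g * X) (g * Y) *_) gcd≡g ⟨
    redR (g * X) (g * Y) * gcd (g * X) (g * Y) ≡⟨ _∣_.equality (gcd[m,n]∣n (g * X) (g * Y)) ⟨
    g * Y                                      ≡⟨ *-comm g Y ⟩
    Y * g                                      ∎)
    where open ≡-Reasoning

repunit : ℕ → ℕ → ℕ
repunit r zero    = 0
repunit r (suc m) = 1 + r * repunit r m

^-repunit : ∀ r' m → suc r' ^ m ≡ 1 + r' * repunit (suc r') m
^-repunit r' zero    = cong suc (sym (*-zeroʳ r'))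
^-repunit r' (suc m) = begin
  suc r' * suc r' ^ m                        ≡⟨ cong (suc r' *_) (^-repunit r' m) ⟩
  suc r' * (1 + r' * S)                      ≡⟨ solve 2 (λ r' S → (con 1 :+ r') :* (con 1 :+ r' :* S)
                                                  := con 1 :+ r' :* (con 1 :+ (con 1 :+ r') :* S)) refl r' S ⟩
  1 + r' * (1 + suc r' * S)                  ∎
  where
  open ≡-Reasoning
  S : ℕ
  S = repunit (suc r') m

parity-repunit-suc : ∀ r m → parity (repunit r (suc m)) ≡ (parity r ℙ.* parity (repunit r m)) ⁻¹
parity-repunit-suc r m = trans (+-homo-+ 1 (r * repunit r m)) (cong _⁻¹ (*-homo-* r (repunit r m)))

∃-neg-inverse : ∀ {p k} .{{_ : NonZero k}} → Coprime p k → ∃[ t ] t < k × k ∣ p * t + 1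
∃-neg-inverse {p} {k@(suc k')} coprime = t₀ % k , m%n<n t₀ k , k∣pt+1
  where
  inverse : ∃[ t₀ ] k ∣ p * t₀ + 1
  inverse with coprime-Bézout coprime
  ... | Bézout.+- x y 1+yk≡xp = k' * x , divides (1 + k' * y) (begin
          p * (k' * x) + 1           ≡⟨ solve 3 (λ p k' x → p :* (k' :* x) :+ con 1 := k' :* (x :* p) :+ con 1)
                                          refl p k' x ⟩
          k' * (x * p) + 1           ≡⟨ cong (λ z → k' * z + 1) 1+yk≡xp ⟨
          k' * (1 + y * k) + 1       ≡⟨ solve 2 (λ k' y → k' :* (con 1 :+ y :* (con 1 :+ k')) :+ con 1
                                          := (con 1 :+ k' :* y) :* (con 1 :+ k')) refl k' y ⟩
          (1 + k' * y) * k           ∎)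
    where open ≡-Reasoning
  ... | Bézout.-+ x y 1+xp≡yk = x , divides y (trans (+-comm (p * x) 1) (trans (cong suc (*-comm p x)) 1+xp≡yk))
  t₀ : ℕ
  t₀ = proj₁ inverse
  k∣pt+1 : k ∣ p * (t₀ % k) + 1
  k∣pt+1 = ∣m+n∣m⇒∣n (subst (k ∣_) split (proj₂ inverse)) (n∣m*n (p * (t₀ / k)))
    where
    split : p * t₀ + 1 ≡ p * (t₀ / k) * k + (p * (t₀ % k) + 1)
    split = begin
      p * t₀ + 1                                  ≡⟨ cong (λ z → p * z + 1) (m≡m%n+[m/n]*n t₀ k) ⟩
      p * (t₀ % k + t₀ / k * k) + 1               ≡⟨ solve 4 (λ p r q k → p :* (r :+ q :* k) :+ con 1
                                                       := p :* q :* k :+ (p :* r :+ con 1))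
                                                        refl p (t₀ % k) (t₀ / k) k ⟩
      p * (t₀ / k) * k + (p * (t₀ % k) + 1)       ∎
      where open ≡-Reasoning

-- The parity of u * v for the representation X u + Y v = X Y + 1 built in Sequence, in terms of
-- the parities π κ δ τ ς of p k g t s and σ of repunit r m; α is then the parity of a and σ′ that
-- of repunit r (suc m).  The hypothesis (π τ)⁻¹ ≡ ς κ below is the parity of p t + 1 ≡ s k.
witness-parity : (π κ δ τ ς σ : Parity) → Parity
witness-parity π κ δ τ ς σ =
  (ς ℙ.+ (α ℙ.* (τ ℙ.* σ′)) ℙ.+ δ) ℙ.* ((π ℙ.+ (κ ℙ.* (α ℙ.* σ))) ℙ.+ (ς ℙ.+ (α ℙ.* (τ ℙ.* σ))))
  where
  α σ′ : Parity
  α  = (π ℙ.* δ) ⁻¹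
  σ′ = ((κ ℙ.* δ) ⁻¹ ℙ.* σ) ⁻¹

witness-parity-constant : ∀ π κ δ τ ς σ → δ ≡ 1ℙ → (π ℙ.* τ) ⁻¹ ≡ ς ℙ.* κ →
                          witness-parity π κ δ τ ς σ ≡ witness-parity π κ δ τ ς 0ℙ
witness-parity-constant _  _  _ _  _  0ℙ refl _  = refl
witness-parity-constant 0ℙ _  _ _  0ℙ 1ℙ refl ()
witness-parity-constant 0ℙ 0ℙ _ _  1ℙ 1ℙ refl ()
witness-parity-constant 0ℙ 1ℙ _ 0ℙ 1ℙ 1ℙ refl _  = refl
witness-parity-constant 0ℙ 1ℙ _ 1ℙ 1ℙ 1ℙ refl _  = refl
witness-parity-constant 1ℙ _  _ 0ℙ 0ℙ 1ℙ refl ()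
witness-parity-constant 1ℙ 0ℙ _ 0ℙ 1ℙ 1ℙ refl ()
witness-parity-constant 1ℙ 1ℙ _ 0ℙ 1ℙ 1ℙ refl _  = refl
witness-parity-constant 1ℙ 0ℙ _ 1ℙ 0ℙ 1ℙ refl _  = refl
witness-parity-constant 1ℙ 0ℙ _ 1ℙ 1ℙ 1ℙ refl _  = refl
witness-parity-constant 1ℙ 1ℙ _ 1ℙ 0ℙ 1ℙ refl _  = refl
witness-parity-constant 1ℙ 1ℙ _ 1ℙ 1ℙ 1ℙ refl ()

witness-parity-vanishes : ∀ π κ δ τ ς σ → π ≡ 1ℙ → δ ≡ 1ℙ → ς ≡ 1ℙ → (π ℙ.* τ) ⁻¹ ≡ ς ℙ.* κ →
                          witness-parity π κ δ τ ς σ ≡ 0ℙ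
witness-parity-vanishes _ _ _ 0ℙ _ 0ℙ refl refl refl refl = refl
witness-parity-vanishes _ _ _ 0ℙ _ 1ℙ refl refl refl refl = refl
witness-parity-vanishes _ _ _ 1ℙ _ 0ℙ refl refl refl refl = refl
witness-parity-vanishes _ _ _ 1ℙ _ 1ℙ refl refl refl refl = refl

witness-parity-flips : ∀ π κ δ τ ς σ → δ ≡ 0ℙ → (π ℙ.* τ) ⁻¹ ≡ ς ℙ.* κ →
                       witness-parity π κ δ τ ς (σ ⁻¹) ≡ witness-parity π κ δ τ ς σ ⁻¹
witness-parity-flips 0ℙ _  _ _  0ℙ _  refl ()
witness-parity-flips 0ℙ 0ℙ _ _  1ℙ _  refl ()
witness-parity-flips 0ℙ 1ℙ _ 0ℙ 1ℙ 0ℙ refl _  = refl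
witness-parity-flips 0ℙ 1ℙ _ 0ℙ 1ℙ 1ℙ refl _  = refl
witness-parity-flips 0ℙ 1ℙ _ 1ℙ 1ℙ 0ℙ refl _  = refl
witness-parity-flips 0ℙ 1ℙ _ 1ℙ 1ℙ 1ℙ refl _  = refl
witness-parity-flips 1ℙ _  _ 0ℙ 0ℙ _  refl ()
witness-parity-flips 1ℙ 0ℙ _ 0ℙ 1ℙ _  refl ()
witness-parity-flips 1ℙ 1ℙ _ 0ℙ 1ℙ 0ℙ refl _  = refl
witness-parity-flips 1ℙ 1ℙ _ 0ℙ 1ℙ 1ℙ refl _  = refl
witness-parity-flips 1ℙ 0ℙ _ 1ℙ 0ℙ 0ℙ refl _  = refl
witness-parity-flips 1ℙ 0ℙ _ 1ℙ 0ℙ 1ℙ refl _  = refl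
witness-parity-flips 1ℙ 1ℙ _ 1ℙ 0ℙ 0ℙ refl _  = refl
witness-parity-flips 1ℙ 1ℙ _ 1ℙ 0ℙ 1ℙ refl _  = refl
witness-parity-flips 1ℙ 0ℙ _ 1ℙ 1ℙ 0ℙ refl _  = refl
witness-parity-flips 1ℙ 0ℙ _ 1ℙ 1ℙ 1ℙ refl _  = refl
witness-parity-flips 1ℙ 1ℙ _ 1ℙ 1ℙ _  refl ()

module Sequence (a r' : ℕ) (1≤a : 1 ≤ a) (1≤r' : 1 ≤ r') where

  r g : ℕ
  r = suc r'
  g = gcd (a + 1) r'

  instance
    g-nonZero : NonZero g
    g-nonZero = ≢-nonZero (gcd[m,n]≢0 (a + 1) r' (inj₁ (m+1+n≢0 a)))

  p k : ℕ
  p = _∣_.quotient (gcd[m,n]∣m (a + 1) r')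
  k = _∣_.quotient (gcd[m,n]∣n (a + 1) r')

  a+1≡p*g : a + 1 ≡ p * g
  a+1≡p*g = _∣_.equality (gcd[m,n]∣m (a + 1) r')

  r'≡k*g : r' ≡ k * g
  r'≡k*g = _∣_.equality (gcd[m,n]∣n (a + 1) r')

  instance
    k-nonZero : NonZero k
    k-nonZero = ≢-nonZero λ k≡0 → m<n⇒n≢0 1≤r' (trans r'≡k*g (cong (_* g) k≡0))

  1≤p : 1 ≤ p
  1≤p = n≢0⇒n>0 λ p≡0 → m+1+n≢0 a (trans a+1≡p*g (cong (_* g) p≡0))

  coprime-p-k : Coprime p k
  coprime-p-k = GCD≡1⇒coprime (GCD-* (subst₂ (λ m n → GCD m n (1 * g)) a+1≡p*g r'≡k*g
                                        (subst (GCD (a + 1) r') (sym (*-identityˡ g)) (gcd-GCD (a + 1) r'))))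

  t : ℕ
  t = proj₁ (∃-neg-inverse coprime-p-k)

  t<k : t < k
  t<k = proj₁ (proj₂ (∃-neg-inverse coprime-p-k))

  s : ℕ
  s = _∣_.quotient (proj₂ (proj₂ (∃-neg-inverse coprime-p-k)))

  pt+1≡sk : p * t + 1 ≡ s * k
  pt+1≡sk = _∣_.equality (proj₂ (proj₂ (∃-neg-inverse coprime-p-k)))

  S : ℕ → ℕ
  S = repunit r

  A : ℕ → ℕ
  A m = p + k * (a * S m)

  -- By k*W below W m inverts k modulo A m, and A (suc m) ≡ - k modulo A m by A-step; this is
  -- where the representation with v = A m ∸ W m comes from.
  W : ℕ → ℕ
  W m = s + a * (t * S m)

  seqA≡g*A : ∀ m → seqA a r (suc m) ≡ g * A m
  seqA≡g*A m = begin
    a * r ^ m + 1                  ≡⟨ cong (λ z → a * z + 1) (^-repunit r' m) ⟩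
    a * (1 + r' * S m) + 1         ≡⟨ cong (λ z → a * (1 + z * S m) + 1) r'≡k*g ⟩
    a * (1 + k * g * S m) + 1      ≡⟨ solve 4 (λ a k g S → a :* (con 1 :+ k :* g :* S) :+ con 1
                                         := a :+ con 1 :+ g :* (k :* (a :* S))) refl a k g (S m) ⟩
    a + 1 + g * (k * (a * S m))    ≡⟨ cong (_+ g * (k * (a * S m))) a+1≡p*g ⟩
    p * g + g * (k * (a * S m))    ≡⟨ solve 4 (λ p g k aS → p :* g :+ g :* (k :* aS) := g :* (p :+ k :* aS))
                                          refl p g k (a * S m) ⟩
    g * A m                        ∎
    where open ≡-Reasoning

  A-step : ∀ m → A (suc m) + k ≡ r * A m
  A-step m = begin
    p + k * (a * (1 + r * S m)) + k    ≡⟨ solve 5 (λ p k a r' S → p :+ k :* (a :* (con 1 :+ (con 1 :+ r') :* S)) :+ k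
                                             := p :+ k :* (a :+ con 1) :+ k :* (a :* S) :+ r' :* (k :* (a :* S)))
                                             refl p k a r' (S m) ⟩
    p + k * (a + 1) + B + r' * B       ≡⟨ cong (λ z → p + z + B + r' * B) k*[a+1]≡r'*p ⟩
    p + r' * p + B + r' * B            ≡⟨ solve 4 (λ p r' k aS → p :+ r' :* p :+ k :* aS :+ r' :* (k :* aS)
                                             := (con 1 :+ r') :* (p :+ k :* aS)) refl p r' k (a * S m) ⟩
    r * A m                            ∎
    where
    open ≡-Reasoning
    B : ℕ
    B = k * (a * S m)
    k*[a+1]≡r'*p : k * (a + 1) ≡ r' * p
    k*[a+1]≡r'*p = begin
      k * (a + 1)  ≡⟨ cong (k *_) a+1≡p*g ⟩
      k * (p * g)  ≡⟨ solve 3 (λ k p g → k :* (p :* g) := k :* g :* p) refl k p g ⟩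
      k * g * p    ≡⟨ cong (_* p) r'≡k*g ⟨
      r' * p       ∎

  k*W : ∀ m → k * W m ≡ A m * t + 1
  k*W m = begin
    k * (s + a * (t * S m))            ≡⟨ solve 5 (λ k s a t S → k :* (s :+ a :* (t :* S)) := s :* k :+ k :* (a :* S) :* t)
                                              refl k s a t (S m) ⟩
    s * k + k * (a * S m) * t          ≡⟨ cong (_+ k * (a * S m) * t) pt+1≡sk ⟨
    p * t + 1 + k * (a * S m) * t      ≡⟨ solve 3 (λ p t kaS → p :* t :+ con 1 :+ kaS :* t := (p :+ kaS) :* t :+ con 1)
                                              refl p t (k * (a * S m)) ⟩
    A m * t + 1                        ∎
    where open ≡-Reasoning

  A-suc≥2 : ∀ m → 2 ≤ A (suc m)
  A-suc≥2 m = +-mono-≤ 1≤p (*-mono-≤ (>-nonZero⁻¹ k) (*-mono-≤ 1≤a (s≤s z≤n)))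

  W<A : ∀ m → 2 ≤ A m → W m < A m
  W<A m 2≤A = *-cancelˡ-< k (W m) (A m) (begin-strict
    k * W m        ≡⟨ k*W m ⟩
    A m * t + 1    <⟨ +-monoʳ-< (A m * t) 2≤A ⟩
    A m * t + A m  ≡⟨ trans (+-comm (A m * t) (A m)) (sym (*-suc (A m) t)) ⟩
    A m * suc t    ≤⟨ *-monoʳ-≤ (A m) t<k ⟩
    A m * k        ≡⟨ *-comm (A m) k ⟩
    k * A m        ∎)
    where open ≤-Reasoning

  cross-identity : ∀ m → A m * (W (suc m) + g) ≡ A (suc m) * W m + 1
  cross-identity m = *-cancelˡ-≡ _ _ k (begin
    k * (X * (W′ + g))               ≡⟨ solve 4 (λ k X W′ g → k :* (X :* (W′ :+ g)) := X :* (k :* W′) :+ k :* g :* X)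
                                            refl k X W′ g ⟩
    X * (k * W′) + k * g * X         ≡⟨ cong₂ (λ z w → X * z + w * X) (k*W (suc m)) (sym r'≡k*g) ⟩
    X * (Y * t + 1) + r' * X         ≡⟨ solve 4 (λ X Y t r' → X :* (Y :* t :+ con 1) :+ r' :* X
                                            := X :* Y :* t :+ (con 1 :+ r') :* X) refl X Y t r' ⟩
    X * Y * t + r * X                ≡⟨ cong (X * Y * t +_) (A-step m) ⟨
    X * Y * t + (Y + k)              ≡⟨ solve 4 (λ X Y t k → X :* Y :* t :+ (Y :+ k) := Y :* (X :* t :+ con 1) :+ k)
                                            refl X Y t k ⟩
    Y * (X * t + 1) + k              ≡⟨ cong (λ z → Y * z + k) (k*W m) ⟨
    Y * (k * W m) + k                ≡⟨ solve 3 (λ Y k W → Y :* (k :* W) :+ k := k :* (Y :* W :+ con 1))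
                                            refl Y k (W m) ⟩
    k * (Y * W m + 1)                ∎)
    where
    open ≡-Reasoning
    X Y W′ : ℕ
    X  = A m
    Y  = A (suc m)
    W′ = W (suc m)

  representation : ∀ m → 2 ≤ A m → A m * (W (suc m) + g) + A (suc m) * (A m ∸ W m) ≡ A m * A (suc m) + 1
  representation m 2≤A = begin
    X * (W (suc m) + g) + Y * (X ∸ W m)   ≡⟨ cong (_+ Y * (X ∸ W m)) (cross-identity m) ⟩
    Y * W m + 1 + Y * (X ∸ W m)           ≡⟨ solve 3 (λ Y W v → Y :* W :+ con 1 :+ Y :* v := Y :* (W :+ v) :+ con 1)
                                                 refl Y (W m) (X ∸ W m) ⟩
    Y * (W m + (X ∸ W m)) + 1             ≡⟨ cong (λ z → Y * z + 1) (m+[n∸m]≡n (<⇒≤ (W<A m 2≤A))) ⟩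
    Y * X + 1                             ≡⟨ cong (_+ 1) (*-comm Y X) ⟩
    X * Y + 1                             ∎
    where
    open ≡-Reasoning
    X Y : ℕ
    X = A m
    Y = A (suc m)

  π κ δ τ ς : Parity
  π = parity p
  κ = parity k
  δ = parity g
  τ = parity t
  ς = parity s

  σ : ℕ → Parity
  σ m = parity (S m)

  α : Parity
  α = (π ℙ.* δ) ⁻¹

  parity-a : parity a ≡ α
  parity-a = sym (⁻¹-selfInverse (begin
    parity a ⁻¹     ≡⟨ parity-+1 a ⟨
    parity (a + 1)  ≡⟨ cong parity a+1≡p*g ⟩
    parity (p * g)  ≡⟨ *-homo-* p g ⟩
    π ℙ.* δ         ∎))
    where open ≡-Reasoning

  parity-pt+1≡sk : (π ℙ.* τ) ⁻¹ ≡ ς ℙ.* κ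
  parity-pt+1≡sk = begin
    (π ℙ.* τ) ⁻¹        ≡⟨ cong _⁻¹ (*-homo-* p t) ⟨
    parity (p * t) ⁻¹   ≡⟨ parity-+1 (p * t) ⟨
    parity (p * t + 1)  ≡⟨ cong parity pt+1≡sk ⟩
    parity (s * k)      ≡⟨ *-homo-* s k ⟩
    ς ℙ.* κ             ∎
    where open ≡-Reasoning

  σ-suc : ∀ m → σ (suc m) ≡ ((κ ℙ.* δ) ⁻¹ ℙ.* σ m) ⁻¹
  σ-suc m = trans (parity-repunit-suc r m) (cong (λ ρ → (ρ ℙ.* σ m) ⁻¹) parity-r)
    where
    parity-r : parity r ≡ (κ ℙ.* δ) ⁻¹
    parity-r = trans (+-homo-+ 1 r') (cong _⁻¹ (trans (cong parity r'≡k*g) (*-homo-* k g)))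

  parity-A : ∀ m → parity (A m) ≡ π ℙ.+ (κ ℙ.* (α ℙ.* σ m))
  parity-A m = trans (+-homo-+ p _) (cong (π ℙ.+_) (trans (*-homo-* k _)
                 (cong (κ ℙ.*_) (trans (*-homo-* a (S m)) (cong (ℙ._* σ m) parity-a)))))

  parity-W : ∀ m → parity (W m) ≡ ς ℙ.+ (α ℙ.* (τ ℙ.* σ m))
  parity-W m = trans (+-homo-+ s _) (cong (ς ℙ.+_) (trans (*-homo-* a _)
                 (cong₂ ℙ._*_ parity-a (*-homo-* t (S m)))))

  usesE1-parity : ℕ → Parity
  usesE1-parity m = witness-parity π κ δ τ ς (σ m)

  usesE1⇔parity≡1ℙ : ∀ m → 2 ≤ A m → UsesE1 (A m) (A (suc m)) ⇔ (usesE1-parity m ≡ 1ℙ)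
  usesE1⇔parity≡1ℙ m 2≤A =
    subst (λ e → UsesE1 (A m) (A (suc m)) ⇔ (e ≡ 1ℙ)) (cong₂ ℙ._*_ parity-u parity-v)
      (usesE1⇔odd-representation (≤-trans (s≤s z≤n) 2≤A) (A-suc≥2 m) (m<n⇒0<n∸m (W<A m 2≤A))
        (representation m 2≤A))
    where
    parity-u : parity (W (suc m) + g) ≡ ς ℙ.+ (α ℙ.* (τ ℙ.* ((κ ℙ.* δ) ⁻¹ ℙ.* σ m) ⁻¹)) ℙ.+ δ
    parity-u = trans (+-homo-+ (W (suc m)) g)
                 (cong (ℙ._+ δ) (trans (parity-W (suc m)) (cong (λ σ′ → ς ℙ.+ (α ℙ.* (τ ℙ.* σ′))) (σ-suc m))))
    parity-v : parity (A m ∸ W m) ≡ (π ℙ.+ (κ ℙ.* (α ℙ.* σ m))) ℙ.+ (ς ℙ.+ (α ℙ.* (τ ℙ.* σ m)))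
    parity-v = trans (parity-∸ (<⇒≤ (W<A m 2≤A))) (cong₂ ℙ._+_ (parity-A m) (parity-W m))

  Γ-consecutive : ∀ m → 2 ≤ A m →
                  GammaIs (seqA a r (suc m)) (seqA a r (suc (suc m))) (gammaOf (usesE1-parity m))
  Γ-consecutive m 2≤A =
    subst₂ (λ x y → GammaIs x y (gammaOf (usesE1-parity m))) (sym (seqA≡g*A m)) (sym (seqA≡g*A (suc m)))
      (GammaIs-gammaOf {g * A m} {g * A (suc m)} (usesE1-parity m)
        (subst₂ (λ X Y → UsesE1 X Y ⇔ (usesE1-parity m ≡ 1ℙ))
          (sym (redL-*-coprime g coprime)) (sym (redR-*-coprime g coprime)) (usesE1⇔parity≡1ℙ m 2≤A)))
    where
    coprime : Coprime (A m) (A (suc m))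
    coprime = representation⇒coprime (representation m 2≤A)

  a+1∣r'⇔p≡1 : (a + 1) ∣ r' ⇔ p ≡ 1
  a+1∣r'⇔p≡1 = mk⇔
    (λ a+1∣r' → coprime-p-k (∣-refl , *-cancelʳ-∣ g (subst₂ _∣_ a+1≡p*g r'≡k*g a+1∣r')))
    (λ p≡1 → subst (_∣ r') (sym (trans a+1≡p*g (trans (cong (_* g) p≡1) (*-identityˡ g))))
                   (gcd[m,n]∣n (a + 1) r'))

  p≡1⇒s≡1 : p ≡ 1 → s ≡ 1
  p≡1⇒s≡1 p≡1 = ≤-antisym (*-cancelʳ-≤ s 1 k (subst₂ _≤_ (sym s*k≡1+t) (sym (*-identityˡ k)) t<k))
                          (n≢0⇒n>0 λ s≡0 → 1+n≢0 (trans (sym s*k≡1+t) (cong (_* k) s≡0)))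
    where
    s*k≡1+t : s * k ≡ suc t
    s*k≡1+t = begin
      s * k      ≡⟨ pt+1≡sk ⟨
      p * t + 1  ≡⟨ cong (λ z → z * t + 1) p≡1 ⟩
      1 * t + 1  ≡⟨ cong (_+ 1) (*-identityˡ t) ⟩
      t + 1      ≡⟨ +-comm t 1 ⟩
      suc t      ∎
      where open ≡-Reasoning

  Γ-constant-if-g-odd-and-a+1∤r' : ¬ 2 ∣ g → ¬ (a + 1) ∣ r' →
                                   ∀ n → 1 ≤ n → GammaIs (seqA a r n) (seqA a r (suc n)) (gammaOf (usesE1-parity 0))
  Γ-constant-if-g-odd-and-a+1∤r' ¬2∣g ¬a+1∣r' (suc m) _ =
    subst (λ e → GammaIs (seqA a r (suc m)) (seqA a r (suc (suc m))) (gammaOf e))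
      (witness-parity-constant π κ δ τ ς (σ m) (¬2∣⇒parity≡1ℙ ¬2∣g) parity-pt+1≡sk)
      (Γ-consecutive m (2≤A m))
    where
    2≤p : 2 ≤ p
    2≤p = ≤∧≢⇒< 1≤p λ 1≡p → ¬a+1∣r' (Equivalence.from a+1∣r'⇔p≡1 (sym 1≡p))
    2≤A : ∀ m → 2 ≤ A m
    2≤A zero    = ≤-trans 2≤p (m≤m+n p _)
    2≤A (suc m) = A-suc≥2 m

  Γ-if-g-odd-and-a+1∣r' : ¬ 2 ∣ g → (a + 1) ∣ r' →
                          GammaIs (seqA a r 1) (seqA a r 2) 1
                          × (∀ n → 2 ≤ n → GammaIs (seqA a r n) (seqA a r (suc n)) 2)
  Γ-if-g-odd-and-a+1∣r' ¬2∣g a+1∣r' = first , later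
    where
    p≡1 : p ≡ 1
    p≡1 = Equivalence.to a+1∣r'⇔p≡1 a+1∣r'
    A0≡1 : A 0 ≡ 1
    A0≡1 = trans (cong (λ z → p + k * z) (*-zeroʳ a))
                 (trans (cong (p +_) (*-zeroʳ k)) (trans (+-identityʳ p) p≡1))
    first : GammaIs (seqA a r 1) (seqA a r 2) 1
    first = subst₂ (λ x y → GammaIs x y 1) (sym (seqA≡g*A 0)) (sym (seqA≡g*A 1)) (inj₁ (refl , usesE1))
      where
      Y : ℕ
      Y = redR (g * A 0) (g * A 1)
      redL≡1 : redL (g * A 0) (g * A 1) ≡ 1
      redL≡1 = trans (redL-*-coprime g (subst (λ X → Coprime X (A 1)) (sym A0≡1) (1-coprimeTo (A 1)))) A0≡1
      usesE1 : UsesE1 (redL (g * A 0) (g * A 1)) Y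
      usesE1 = subst (λ X → UsesE1 X Y) (sym redL≡1) (usesE1-1 Y)
    later : ∀ n → 2 ≤ n → GammaIs (seqA a r n) (seqA a r (suc n)) 2
    later (suc zero) (s≤s ())
    later (suc (suc m)) _ =
      subst (λ e → GammaIs (seqA a r (suc (suc m))) (seqA a r (suc (suc (suc m)))) (gammaOf e))
        (witness-parity-vanishes π κ δ τ ς (σ (suc m)) (cong parity p≡1) (¬2∣⇒parity≡1ℙ ¬2∣g)
                                 (cong parity (p≡1⇒s≡1 p≡1)) parity-pt+1≡sk)
        (Γ-consecutive (suc m) (A-suc≥2 m))

  Γ-alternates-if-g-even : 2 ∣ g → ∀ n → 2 ≤ n → ∀ c → GammaIs (seqA a r n) (seqA a r (suc n)) c →
                           GammaIs (seqA a r (suc n)) (seqA a r (suc (suc n))) (3 ∸ c)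
  Γ-alternates-if-g-even 2∣g (suc zero) (s≤s ())
  Γ-alternates-if-g-even 2∣g (suc (suc m)) _ c Γ≡c =
    subst (λ c → GammaIs (seqA a r (3 + m)) (seqA a r (4 + m)) (3 ∸ c)) (sym c≡)
      (subst (GammaIs (seqA a r (3 + m)) (seqA a r (4 + m))) next≡
        (Γ-consecutive (suc (suc m)) (A-suc≥2 (suc m))))
    where
    δ≡0ℙ : δ ≡ 0ℙ
    δ≡0ℙ = 2∣⇒parity≡0ℙ 2∣g
    c≡ : c ≡ gammaOf (usesE1-parity (suc m))
    c≡ = GammaIs-functional {seqA a r (2 + m)} {seqA a r (3 + m)} Γ≡c (Γ-consecutive (suc m) (A-suc≥2 m))
    σ-flip : σ (2 + m) ≡ σ (suc m) ⁻¹
    σ-flip = trans (σ-suc (suc m)) (trans (cong (λ x → ((κ ℙ.* x) ⁻¹ ℙ.* σ (suc m)) ⁻¹) δ≡0ℙ)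
                                          (cong (λ x → (x ⁻¹ ℙ.* σ (suc m)) ⁻¹) (ℙ.*-zeroʳ κ)))
    next≡ : gammaOf (usesE1-parity (2 + m)) ≡ 3 ∸ gammaOf (usesE1-parity (suc m))
    next≡ = begin
      gammaOf (usesE1-parity (2 + m))                    ≡⟨ cong (λ x → gammaOf (witness-parity π κ δ τ ς x)) σ-flip ⟩
      gammaOf (witness-parity π κ δ τ ς (σ (suc m) ⁻¹))  ≡⟨ cong gammaOf (witness-parity-flips π κ δ τ ς _ δ≡0ℙ
                                                                                                   parity-pt+1≡sk) ⟩
      gammaOf (usesE1-parity (suc m) ⁻¹)                 ≡⟨ 3∸gammaOf _ ⟨
      3 ∸ gammaOf (usesE1-parity (suc m))                ∎
      where open ≡-Reasoning

theorem1p5 : (a r : ℕ) → 1 ≤ a → 2 ≤ r →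
    ((¬ (2 ∣ gcd (a + 1) (r ∸ 1))) →
      ((¬ ((a + 1) ∣ (r ∸ 1))) →
        ∃ λ c → ∀ n → 1 ≤ n → GammaIs (seqA a r n) (seqA a r (suc n)) c)
      × (((a + 1) ∣ (r ∸ 1)) →
        GammaIs (seqA a r 1) (seqA a r 2) 1
        × (∀ n → 2 ≤ n → GammaIs (seqA a r n) (seqA a r (suc n)) 2)))
    × ((2 ∣ gcd (a + 1) (r ∸ 1)) →
      ∀ n → 2 ≤ n → ∀ c → GammaIs (seqA a r n) (seqA a r (suc n)) c →
        GammaIs (seqA a r (suc n)) (seqA a r (suc (suc n))) (3 ∸ c))
theorem1p5 a (suc r') 1≤a (s≤s 1≤r') =
  (λ ¬2∣g → (λ ¬a+1∣r' → gammaOf (usesE1-parity 0) , Γ-constant-if-g-odd-and-a+1∤r' ¬2∣g ¬a+1∣r')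
          , Γ-if-g-odd-and-a+1∣r' ¬2∣g)
  , Γ-alternates-if-g-even
  where open Sequence a r' 1≤a 1≤r'
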